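{- For all integers $1\le s\le t< n$, $\tilde{R}(\dot C_t^{(b)}\sqcup \dot C_s^{(r)},Q_n)=n+t+1$.
   Context: $Q_N$ denotes the Boolean lattice of all subsets of an $N$-element set ordered by inclusion. An (induced) copy of a poset $P$ in a poset $Q$ is a subset of $Q$ which, with the inherited order, is isomorphic to $P$. A colored poset $\dot P$ is a poset with a coloring of its elements in blue and red; a copy of $\dot P$ in a colored $Q$ is an induced copy of $P$ whose vertices have the same colors as the corresponding vertices of $\dot P$. $C_t$ is a chain on $t$ vertices; $\dot C_t^{(b)}$ is $C_t$ colored all blue and $\dot C_s^{(r)}$ is $C_s$ colored all red. $\dot P_1\sqcup\dot P_2$ denotes the colored poset consisting of disjoint copies of $\dot P_1$ and $\dot P_2$ in which every vertex of one is incomparable to every vertex of the other. $\dot Q_n^{(b)}$ (resp. $\dot Q_n^{(r)}$) is $Q_n$ colored entirely blue (resp. red). $\tilde{R}(\dot P,Q_n)$ is the minimum $N$ such that every blue/red coloring of $Q_N$ contains a copy of $\dot P$, of $\dot Q_n^{(b)}$, or of $\dot Q_n^{(r)}$. -}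

module Defs where

open import Data.Nat using (ℕ; _<_)
open import Data.Fin using (Fin)
import Data.Fin as F
open import Data.Fin.Subset using (Subset; _⊆_)
open import Data.Sum using (_⊎_; inj₁; inj₂)
open import Data.Product using (Σ; _×_)
open import Data.Empty using (⊥)
open import Relation.Binary.PropositionalEquality using (_≡_)
open import Function.Definitions using (Injective)
open import Function.Bundles using (_⇔_)

data Colour : Set where
  blue red : Colour

record CPoset : Set₁ where
  field
    Carrier : Set
    _≼_     : Carrier → Carrier → Set
    colour  : Carrier → Colour
open CPoset public

Colouring : ℕ → Set
Colouring N = Subset N → Colour

Contains : {N : ℕ} → Colouring N → CPoset → Set
Contains {N} c P =
  Σ (Carrier P → Subset N) λ f →
    Injective _≡_ _≡_ f
    × (∀ x y → (_≼_ P x y ⇔ (f x ⊆ f y)))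
    × (∀ x → c (f x) ≡ colour P x)

monoQ : ℕ → Colour → CPoset
monoQ n k = record { Carrier = Subset n ; _≼_ = _⊆_ ; colour = λ _ → k }

chain : ℕ → Colour → CPoset
chain t k = record { Carrier = Fin t ; _≼_ = F._≤_ ; colour = λ _ → k }

data ⊔Rel (P R : CPoset) : Carrier P ⊎ Carrier R → Carrier P ⊎ Carrier R → Set where
  left  : ∀ {x y} → _≼_ P x y → ⊔Rel P R (inj₁ x) (inj₁ y)
  right : ∀ {x y} → _≼_ R x y → ⊔Rel P R (inj₂ x) (inj₂ y)

_⊔_ : CPoset → CPoset → CPoset
P ⊔ R = record
  { Carrier = Carrier P ⊎ Carrier R
  ; _≼_ = ⊔Rel P R
  ; colour = λ { (inj₁ x) → colour P x ; (inj₂ y) → colour R y } }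

Arrows : CPoset → ℕ → ℕ → Set
Arrows P n N = (c : Colouring N) →
  Contains c P ⊎ Contains c (monoQ n blue) ⊎ Contains c (monoQ n red)

RtildeEq : CPoset → ℕ → ℕ → Set
RtildeEq P n m = Arrows P n m × (∀ N → N < m → Arrows P n N → ⊥)

-- Upper bound: by induction on k, every colouring of Q_(k+n) contains a chain of
-- k + 1 sets of a prescribed colour b or a copy of Q_n in the other colour.  The
-- step merges the two halves of Q_(1+k+n) into one colouring of Q_(k+n): X gets
-- colour b iff 1∷X has colour b and so does some 0∷Y with Y ⊆ X.  A b-chain of the
-- merged colouring extends downwards by such a 0∷Y, while on a copy of Q_n of the
-- other colour, attaching the bit "some such Y exists" (an up-set) yields a copy in
-- the original colouring.  In Q_(n+t+1) the sublattices 10∷Q_(n+t-1) and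
-- 01∷Q_(n+t-1) are mutually incomparable; looking for a blue t-chain in the first
-- and a red one in the second gives the upper bound.
--
-- Lower bound: on Q_N with N ≤ n + t colour a set blue iff it has fewer than t
-- elements or is the whole ground set.  A blue t-chain must start at a nonempty set
-- (its bottom is not below the incomparable red set) and cannot reach the top, a
-- blue copy of Q_n has a coatom of size at least n - 1 ≥ t, and a red copy of Q_n
-- would need t + n < N levels.

module Submission where

open import Defs
open import Data.Bool.Properties using () renaming (_≟_ to _≟ᵇ_)
open import Data.Empty using (⊥-elim)
open import Data.Fin.Base as Fin using (Fin; zero; suc; fromℕ; inject≤)
import Data.Fin.Properties as Finₚ
open import Data.Fin.Subset using (Subset; _⊆_; _⊈_; _⊂_; ∣_∣; inside; outside; ⊥; ⊤)
open import Data.Fin.Subset.Properties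
  using (⊆-refl; ⊆-trans; ⊆-reflexive; ⊆-antisym; _⊆?_; drop-∷-⊆; s⊆s; out⊆; s⊂s; out⊂; out⊂in;
         p⊂q⇒∣p∣<∣q∣; ⊥⊆; ⊆⊤; ∣⊥∣≡0; ∣p∣≤n; ∣p∣≡n⇒p≡⊤; anySubset?)
open import Data.Nat.Base using (ℕ; zero; suc; _+_; _≤_; _<_; z≤n; s≤s; s≤s⁻¹)
open import Data.Nat.Properties
  using (_<?_; ≤-reflexive; ≤-trans; <⇒≤; <⇒≱; ≮⇒≥; ≤∧≢⇒<; m<1+n⇒m≤n; m≤n+m;
         +-comm; +-suc; +-identityʳ; +-monoˡ-≤; module ≤-Reasoning)
open import Data.Nat.Tactic.RingSolver using (solve-∀)
open import Data.Product.Base using (∃; _×_; _,_; proj₁; proj₂)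
open import Data.Sum.Base using (_⊎_; inj₁; inj₂; [_,_]′)
import Data.Sum.Base as Sum
open import Data.Vec.Base using (_∷_; []; here; there)
open import Data.Vec.Properties using (∷-injectiveʳ; ≡-dec)
open import Function.Base using (_∘_; id; case_of_)
open import Function.Bundles using (_⇔_; mk⇔; Equivalence)
open import Function.Definitions using (Injective)
open import Relation.Binary.Definitions using (Antisymmetric; DecidableEquality)
open import Relation.Binary.PropositionalEquality
  using (_≡_; _≢_; refl; sym; cong; subst; subst₂)
open import Relation.Nullary using (¬_; Dec; yes; no)
open import Relation.Nullary.Decidable using (isYes; _×-dec_; _⊎-dec_)

open Equivalence using (to; from)

other : Colour → Colour
other blue = red
other red  = blue

other-≢ : ∀ k → other k ≢ k
other-≢ blue ()
other-≢ red  ()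

≢⇒≡-other : ∀ {x k} → x ≢ k → x ≡ other k
≢⇒≡-other {blue} {blue} x≢k = ⊥-elim (x≢k refl)
≢⇒≡-other {blue} {red}  _   = refl
≢⇒≡-other {red}  {blue} _   = refl
≢⇒≡-other {red}  {red}  x≢k = ⊥-elim (x≢k refl)

_≟_ : DecidableEquality Colour
blue ≟ blue = yes refl
blue ≟ red  = no λ ()
red  ≟ blue = no λ ()
red  ≟ red  = yes refl

paint : {P : Set} → Colour → Dec P → Colour
paint k (yes _) = k
paint k (no _)  = other k

paint-≡ : ∀ {P : Set} {k} (d : Dec P) → paint k d ≡ k → P
paint-≡ (yes p) _ = p
paint-≡ {k = k} (no _) e = ⊥-elim (other-≢ k e)

paint-≡-other : ∀ {P : Set} {k} (d : Dec P) → paint k d ≡ other k → ¬ P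
paint-≡-other {k = k} (yes _) e = ⊥-elim (other-≢ k (sym e))
paint-≡-other (no ¬p) _ = ¬p

-- mk⇔ cannot recover A and B from the expected type A ⇔ B, and _⊆_ unfolds to an
-- implicit function type, so lambdas into it need their types fixed in advance.
mk⇔-⊆ : ∀ {A : Set} {N} {p q : Subset N} → (A → p ⊆ q) → (p ⊆ q → A) → A ⇔ p ⊆ q
mk⇔-⊆ = mk⇔

mkContains : ∀ {N} {c : Colouring N} {P : CPoset} → Antisymmetric _≡_ (_≼_ P) →
  (f : Carrier P → Subset N) → (∀ x y → _≼_ P x y ⇔ f x ⊆ f y) →
  (∀ x → c (f x) ≡ colour P x) → Contains c P
mkContains antisym f ordered coloured = f , injective , ordered , coloured
  where
  injective : Injective _≡_ _≡_ f
  injective {x} {y} fx≡fy = antisym (from (ordered x y) (⊆-reflexive fx≡fy))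
                                    (from (ordered y x) (⊆-reflexive (sym fx≡fy)))

∷-Contains : ∀ {N} {P : CPoset} (c : Colouring (suc N)) a →
  Contains (λ X → c (a ∷ X)) P → Contains c P
∷-Contains _ a (f , f-inj , f-ord , f-col) =
  (a ∷_) ∘ f , f-inj ∘ ∷-injectiveʳ ,
  (λ x y → mk⇔ (s⊆s ∘ to (f-ord x y)) (from (f-ord x y) ∘ drop-∷-⊆)) , f-col

⊔-Contains : ∀ {N} {c : Colouring (suc (suc N))} {P R : CPoset} →
  Contains (λ X → c (inside ∷ outside ∷ X)) P →
  Contains (λ X → c (outside ∷ inside ∷ X)) R → Contains c (P ⊔ R)
⊔-Contains {N} {c} {P} {R} (f , f-inj , f-ord , f-col) (g , g-inj , g-ord , g-col) =
  h , h-inj , h-ord , h-col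
  where
  h : Carrier (P ⊔ R) → Subset (suc (suc N))
  h (inj₁ x) = inside ∷ outside ∷ f x
  h (inj₂ y) = outside ∷ inside ∷ g y
  h-inj : Injective _≡_ _≡_ h
  h-inj {inj₁ _} {inj₁ _} e = cong inj₁ (f-inj (∷-injectiveʳ (∷-injectiveʳ e)))
  h-inj {inj₂ _} {inj₂ _} e = cong inj₂ (g-inj (∷-injectiveʳ (∷-injectiveʳ e)))
  h-inj {inj₁ _} {inj₂ _} ()
  h-inj {inj₂ _} {inj₁ _} ()
  h-ord : ∀ u v → ⊔Rel P R u v ⇔ h u ⊆ h v
  h-ord (inj₁ x) (inj₁ y) = mk⇔ (λ { (left x≼y) → s⊆s (s⊆s (to (f-ord x y) x≼y)) })
                                (left ∘ from (f-ord x y) ∘ drop-∷-⊆ ∘ drop-∷-⊆)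
  h-ord (inj₂ x) (inj₂ y) = mk⇔ (λ { (right x≼y) → s⊆s (s⊆s (to (g-ord x y) x≼y)) })
                                (right ∘ from (g-ord x y) ∘ drop-∷-⊆ ∘ drop-∷-⊆)
  h-ord (inj₁ _) (inj₂ _) = mk⇔ (λ ()) (λ sub → case sub here of λ ())
  h-ord (inj₂ _) (inj₁ _) = mk⇔ (λ ()) (λ sub → case sub (there here) of λ { (there ()) })
  h-col : ∀ u → c (h u) ≡ colour (P ⊔ R) u
  h-col (inj₁ x) = f-col x
  h-col (inj₂ y) = g-col y

chain-Contains-≤ : ∀ {N} {c : Colouring N} {s t k} → s ≤ t →
  Contains c (chain t k) → Contains c (chain s k)
chain-Contains-≤ {c = c} {s} s≤t (f , _ , f-ord , f-col) =
  mkContains {c = c} Finₚ.≤-antisym (f ∘ ι) ordered (f-col ∘ ι)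
  where
  ι : Fin s → Fin _
  ι i = inject≤ i s≤t
  ordered : ∀ i j → i Fin.≤ j ⇔ f (ι i) ⊆ f (ι j)
  ordered i j = mk⇔
    (to (f-ord (ι i) (ι j)) ∘ subst₂ _≤_ (sym (Finₚ.toℕ-inject≤ i s≤t)) (sym (Finₚ.toℕ-inject≤ j s≤t)))
    (subst₂ _≤_ (Finₚ.toℕ-inject≤ i s≤t) (Finₚ.toℕ-inject≤ j s≤t) ∘ from (f-ord (ι i) (ι j)))

module Merge {m} (c : Colouring (suc m)) (b : Colour) where

  HasLowerBelow : Subset m → Set
  HasLowerBelow X = ∃ λ Y → Y ⊆ X × c (outside ∷ Y) ≡ b

  hasLowerBelow? : ∀ X → Dec (HasLowerBelow X)
  hasLowerBelow? X = anySubset? λ Y → (Y ⊆? X) ×-dec (c (outside ∷ Y) ≟ b)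

  merged : Colouring m
  merged X = paint b ((c (inside ∷ X) ≟ b) ×-dec hasLowerBelow? X)

  merged-≡ : ∀ {X} → merged X ≡ b → c (inside ∷ X) ≡ b × HasLowerBelow X
  merged-≡ {X} = paint-≡ ((c (inside ∷ X) ≟ b) ×-dec hasLowerBelow? X)

  merged-≡-other : ∀ {X} → merged X ≡ other b → ¬ (c (inside ∷ X) ≡ b × HasLowerBelow X)
  merged-≡-other {X} = paint-≡-other ((c (inside ∷ X) ≟ b) ×-dec hasLowerBelow? X)

  extend-chain : ∀ {t} → Contains merged (chain (suc t) b) → Contains c (chain (suc (suc t)) b)
  extend-chain {t} (g , _ , g-ord , g-col) with proj₂ (merged-≡ (g-col zero))
  ... | Y , Y⊆g₀ , Y-col = mkContains {c = c} Finₚ.≤-antisym h h-ord h-col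
    where
    h : Fin (suc (suc t)) → Subset (suc m)
    h zero    = outside ∷ Y
    h (suc i) = inside ∷ g i
    h-ord : ∀ i j → i Fin.≤ j ⇔ h i ⊆ h j
    h-ord zero    zero    = mk⇔-⊆ (λ _ → ⊆-refl) (λ _ → z≤n)
    h-ord zero    (suc j) = mk⇔-⊆ (λ _ → out⊆ (⊆-trans Y⊆g₀ (to (g-ord zero j) z≤n))) (λ _ → z≤n)
    h-ord (suc i) zero    = mk⇔ (λ ()) (λ sub → case sub here of λ ())
    h-ord (suc i) (suc j) = mk⇔ (s⊆s ∘ to (g-ord i j) ∘ s≤s⁻¹) (s≤s ∘ from (g-ord i j) ∘ drop-∷-⊆)
    h-col : ∀ i → c (h i) ≡ b
    h-col zero    = Y-col
    h-col (suc i) = proj₁ (merged-≡ (g-col i))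

  raise : Subset m → Subset (suc m)
  raise X = isYes (hasLowerBelow? X) ∷ X

  raise-mono : ∀ {X X'} → X ⊆ X' → raise X ⊆ raise X'
  raise-mono {X} {X'} X⊆X' with hasLowerBelow? X | hasLowerBelow? X'
  ... | no _  | _     = out⊆ X⊆X'
  ... | yes _ | yes _ = s⊆s X⊆X'
  ... | yes (Y , Y⊆X , Y-col) | no none = ⊥-elim (none (Y , ⊆-trans Y⊆X X⊆X' , Y-col))

  raise-colour : ∀ X → ¬ (c (inside ∷ X) ≡ b × HasLowerBelow X) → c (raise X) ≡ other b
  raise-colour X not-both with hasLowerBelow? X
  ... | yes below = ≢⇒≡-other λ top → not-both (top , below)
  ... | no  none  = ≢⇒≡-other λ bottom → none (X , ⊆-refl , bottom)

  extend-cube : ∀ {n} → Contains merged (monoQ n (other b)) → Contains c (monoQ n (other b))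
  extend-cube (f , _ , f-ord , f-col) =
    mkContains {c = c} ⊆-antisym (raise ∘ f)
      (λ S T → mk⇔ (raise-mono ∘ to (f-ord S T)) (from (f-ord S T) ∘ drop-∷-⊆))
      (λ S → raise-colour (f S) (merged-≡-other (f-col S)))

chain-or-cube : ∀ k n (c : Colouring (k + n)) b →
  Contains c (chain (suc k) b) ⊎ Contains c (monoQ n (other b))
chain-or-cube zero n c b with anySubset? (λ X → c X ≟ b)
... | yes (X , X-col) = inj₁ (mkContains {c = c} Finₚ.≤-antisym (λ _ → X)
                               (λ { zero zero → mk⇔-⊆ (λ _ → ⊆-refl) (λ _ → z≤n) }) (λ _ → X-col))
... | no none = inj₂ (mkContains {c = c} ⊆-antisym id (λ _ _ → mk⇔ id id)
                        (λ X → ≢⇒≡-other λ X-col → none (X , X-col)))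
chain-or-cube (suc k) n c b = Sum.map extend-chain extend-cube (chain-or-cube k n merged b)
  where open Merge c b

Arrows-chain⊔chain : ∀ {s k} n → s ≤ suc k →
  Arrows (chain (suc k) blue ⊔ chain s red) n (2 + (k + n))
Arrows-chain⊔chain {k = k} n s≤t c
  with chain-or-cube k n (λ X → c (inside ∷ outside ∷ X)) blue
     | chain-or-cube k n (λ X → c (outside ∷ inside ∷ X)) red
... | inj₂ red-cube | _ =
  inj₂ (inj₂ (∷-Contains c inside (∷-Contains (λ X → c (inside ∷ X)) outside red-cube)))
... | inj₁ _ | inj₂ blue-cube =
  inj₂ (inj₁ (∷-Contains c outside (∷-Contains (λ X → c (outside ∷ X)) inside blue-cube)))
... | inj₁ blue-chain | inj₁ red-chain =
  inj₁ (⊔-Contains {c = c} blue-chain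
         (chain-Contains-≤ {c = λ X → c (outside ∷ inside ∷ X)} s≤t red-chain))

p⊆q∧q⊈p⇒p⊂q : ∀ {n} {p q : Subset n} → p ⊆ q → q ⊈ p → p ⊂ q
p⊆q∧q⊈p⇒p⊂q {p = []}          {[]}          _   q⊈p = ⊥-elim (q⊈p ⊆-refl)
p⊆q∧q⊈p⇒p⊂q {p = outside ∷ _} {outside ∷ _} p⊆q q⊈p = out⊂ (p⊆q∧q⊈p⇒p⊂q (drop-∷-⊆ p⊆q) (q⊈p ∘ s⊆s))
p⊆q∧q⊈p⇒p⊂q {p = outside ∷ _} {inside  ∷ _} p⊆q _   = out⊂in (drop-∷-⊆ p⊆q)
p⊆q∧q⊈p⇒p⊂q {p = inside  ∷ _} {outside ∷ _} p⊆q _   = case p⊆q here of λ ()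
p⊆q∧q⊈p⇒p⊂q {p = inside  ∷ _} {inside  ∷ _} p⊆q q⊈p = s⊂s (p⊆q∧q⊈p⇒p⊂q (drop-∷-⊆ p⊆q) (q⊈p ∘ s⊆s))

p⊆q∧q⊈p⇒∣p∣<∣q∣ : ∀ {n} {p q : Subset n} → p ⊆ q → q ⊈ p → ∣ p ∣ < ∣ q ∣
p⊆q∧q⊈p⇒∣p∣<∣q∣ p⊆q q⊈p = p⊂q⇒∣p∣<∣q∣ (p⊆q∧q⊈p⇒p⊂q p⊆q q⊈p)

strictMono⇒+-≤ : ∀ {m} (h : Fin (suc m) → ℕ) → (∀ {i j} → i Fin.< j → h i < h j) →
  h zero + m ≤ h (fromℕ m)
strictMono⇒+-≤ {zero}  h _      = ≤-reflexive (+-identityʳ (h zero))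
strictMono⇒+-≤ {suc m} h h-mono = begin
  h zero + suc m     ≡⟨ +-suc (h zero) m ⟩
  suc (h zero) + m   ≤⟨ +-monoˡ-≤ m (h-mono {zero} {suc zero} (s≤s z≤n)) ⟩
  h (suc zero) + m   ≤⟨ strictMono⇒+-≤ (h ∘ suc) (λ i<j → h-mono (s≤s i<j)) ⟩
  h (fromℕ (suc m))  ∎
  where open ≤-Reasoning

chain-size-growth : ∀ {m N} (g : Fin (suc m) → Subset N) →
  (∀ {i j} → i Fin.≤ j → g i ⊆ g j) → (∀ {i j} → g i ⊆ g j → i Fin.≤ j) →
  ∣ g zero ∣ + m ≤ ∣ g (fromℕ m) ∣
chain-size-growth g mono reflect =
  strictMono⇒+-≤ (∣_∣ ∘ g) λ i<j → p⊆q∧q⊈p⇒∣p∣<∣q∣ (mono (<⇒≤ i<j)) (<⇒≱ i<j ∘ reflect)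

cube-size-growth : ∀ {m N} (f : Subset m → Subset N) →
  (∀ {S T} → S ⊆ T → f S ⊆ f T) → (∀ {S T} → f S ⊆ f T → S ⊆ T) →
  ∣ f ⊥ ∣ + m ≤ ∣ f ⊤ ∣
cube-size-growth {zero}  f _    _       = ≤-reflexive (+-identityʳ ∣ f ⊥ ∣)
cube-size-growth {suc m} f mono reflect = begin
  ∣ f ⊥ ∣ + suc m          ≡⟨ +-suc ∣ f ⊥ ∣ m ⟩
  suc (∣ f ⊥ ∣ + m)        ≤⟨ s≤s (cube-size-growth (λ S → f (outside ∷ S))
                                     (λ S⊆T → mono (s⊆s S⊆T)) (λ sub → drop-∷-⊆ (reflect sub))) ⟩
  suc ∣ f (outside ∷ ⊤) ∣  ≤⟨ p⊆q∧q⊈p⇒∣p∣<∣q∣ (mono (out⊆ ⊆-refl)) (λ sub → case reflect sub here of λ ()) ⟩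
  ∣ f ⊤ ∣                  ∎
  where open ≤-Reasoning

threshold : ∀ N → ℕ → Colouring N
threshold N t X = paint blue ((∣ X ∣ <? t) ⊎-dec ≡-dec _≟ᵇ_ X ⊤)

threshold-blue : ∀ {N t} X → threshold N t X ≡ blue → ∣ X ∣ < t ⊎ X ≡ ⊤
threshold-blue {t = t} X = paint-≡ ((∣ X ∣ <? t) ⊎-dec ≡-dec _≟ᵇ_ X ⊤)

threshold-red : ∀ {N t} X → threshold N t X ≡ red → ¬ (∣ X ∣ < t ⊎ X ≡ ⊤)
threshold-red {t = t} X = paint-≡-other ((∣ X ∣ <? t) ⊎-dec ≡-dec _≟ᵇ_ X ⊤)

threshold-chain⊔ : ∀ {N t} {P : CPoset} → Carrier P →
  ¬ Contains (threshold N (suc t)) (chain (suc t) blue ⊔ P)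
threshold-chain⊔ {N} {t} {P} p (f , _ , f-ord , f-col) =
  [ top-not-small , top-not-full ]′ (threshold-blue (B (fromℕ t)) (f-col (inj₁ (fromℕ t))))
  where
  B : Fin (suc t) → Subset N
  B i = f (inj₁ i)
  growth : ∣ B zero ∣ + t ≤ ∣ B (fromℕ t) ∣
  growth = chain-size-growth B (λ i≤j → to (f-ord _ _) (left i≤j))
             (λ sub → case from (f-ord _ _) sub of λ { (left i≤j) → i≤j })
  bottom-nonempty : 0 < ∣ B zero ∣
  bottom-nonempty = subst (_< ∣ B zero ∣) (∣⊥∣≡0 N)
    (p⊆q∧q⊈p⇒∣p∣<∣q∣ ⊥⊆ λ B₀⊆⊥ →
      case from (f-ord _ _) (⊆-trans B₀⊆⊥ (⊥⊆ {p = f (inj₂ p)})) of λ ())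
  top-not-small : ¬ ∣ B (fromℕ t) ∣ < suc t
  top-not-small small = <⇒≱ small (≤-trans (+-monoˡ-≤ t bottom-nonempty) growth)
  top-not-full : B (fromℕ t) ≢ ⊤
  top-not-full top≡⊤ =
    case from (f-ord (inj₂ p) (inj₁ (fromℕ t))) (subst (f (inj₂ p) ⊆_) (sym top≡⊤) ⊆⊤) of λ ()

threshold-blue-cube : ∀ {N n t} → t < n → ¬ Contains (threshold N t) (monoQ n blue)
threshold-blue-cube {N} {suc m} {t} (s≤s t≤m) (f , _ , f-ord , f-col) =
  [ coatom-not-small , coatom-not-full ]′ (threshold-blue coatom (f-col (outside ∷ ⊤)))
  where
  coatom : Subset N
  coatom = f (outside ∷ ⊤)
  growth : ∣ f ⊥ ∣ + m ≤ ∣ coatom ∣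
  growth = cube-size-growth (λ S → f (outside ∷ S))
             (λ S⊆T → to (f-ord _ _) (s⊆s S⊆T)) (λ sub → drop-∷-⊆ (from (f-ord _ _) sub))
  coatom-not-small : ¬ ∣ coatom ∣ < t
  coatom-not-small small = <⇒≱ small (≤-trans t≤m (≤-trans (m≤n+m m ∣ f ⊥ ∣) growth))
  coatom-not-full : coatom ≢ ⊤
  coatom-not-full coatom≡⊤ =
    case from (f-ord ⊤ (outside ∷ ⊤)) (subst (f ⊤ ⊆_) (sym coatom≡⊤) ⊆⊤) here of λ ()

threshold-red-cube : ∀ {N n t} → N ≤ n + t → ¬ Contains (threshold N t) (monoQ n red)
threshold-red-cube {N} {n} {t} N≤n+t (f , _ , f-ord , f-col) = <⇒≱ n+t<N N≤n+t
  where
  bottom-large : t ≤ ∣ f ⊥ ∣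
  bottom-large = ≮⇒≥ (threshold-red {t = t} (f ⊥) (f-col ⊥) ∘ inj₁)
  top-small : ∣ f ⊤ ∣ < N
  top-small = ≤∧≢⇒< (∣p∣≤n (f ⊤)) (threshold-red {t = t} (f ⊤) (f-col ⊤) ∘ inj₂ ∘ ∣p∣≡n⇒p≡⊤)
  n+t<N : n + t < N
  n+t<N = begin-strict
    n + t        ≡⟨ +-comm n t ⟩
    t + n        ≤⟨ +-monoˡ-≤ n bottom-large ⟩
    ∣ f ⊥ ∣ + n  ≤⟨ cube-size-growth f (to (f-ord _ _)) (from (f-ord _ _)) ⟩
    ∣ f ⊤ ∣      <⟨ top-small ⟩
    N            ∎
    where open ≤-Reasoning

¬Arrows-chain⊔ : ∀ {N n t} {P : CPoset} → Carrier P → suc t < n → N ≤ n + suc t →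
  ¬ Arrows (chain (suc t) blue ⊔ P) n N
¬Arrows-chain⊔ {N} {t = t} p t<n N≤n+t arrows =
  [ threshold-chain⊔ p , [ threshold-blue-cube t<n , threshold-red-cube N≤n+t ]′ ]′
    (arrows (threshold N (suc t)))

lemma3 : ∀ (s t n : ℕ) → 1 ≤ s → s ≤ t → t < n →
    RtildeEq (chain t blue ⊔ chain s red) n (n + t + 1)
lemma3 zero    _       _ ()  _   _
lemma3 (suc _) zero    _ _   ()  _
lemma3 (suc s) (suc k) n _ s≤t t<n = upper , lower
  where
  upper : Arrows (chain (suc k) blue ⊔ chain (suc s) red) n (n + suc k + 1)
  upper = subst (Arrows _ n) (size k n) (Arrows-chain⊔chain n s≤t)
    where
    size : ∀ k n → 2 + (k + n) ≡ n + suc k + 1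
    size = solve-∀
  lower : ∀ N → N < n + suc k + 1 → ¬ Arrows (chain (suc k) blue ⊔ chain (suc s) red) n N
  lower N N<n+t+1 = ¬Arrows-chain⊔ zero t<n (m<1+n⇒m≤n (subst (N <_) (+-comm _ 1) N<n+t+1))
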